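{- There exist equivalent reduced expressions $u,v$ (of a permutation of $\{1,\dots,n\}$ for some $n$) such that $\operatorname{dist}(u,v) < \operatorname{rc}(u,v)$.
   Context: For $1\le i\le n-1$, $\sigma_i$ is the transposition exchanging $i$ and $i+1$. An $n$-expression is a word over $\{\sigma_1,\dots,\sigma_{n-1}\}$, representing the product of its letters read left to right; equivalent means same permutation; reduced means no shorter equivalent expression. Braid relations: (I) $\sigma_i\sigma_j\sigma_i=\sigma_j\sigma_i\sigma_j$ for $|i-j|=1$; (II) $\sigma_i\sigma_j=\sigma_j\sigma_i$ for $|i-j|\ge2$; $\operatorname{dist}(u,v)$ is the minimal number of braid-relation applications transforming $u$ into $v$. Reversing: introduce formal letters $\bar\sigma_i$; for a word $w$ in $\sigma_i,\bar\sigma_i$, $\bar w$ is obtained by reversing the letter order and swapping $\sigma_i\leftrightarrow\bar\sigma_i$. One writes $w\curvearrowright w'$ if $w'$ is obtained from $w$ by replacing a subword $\bar\sigma_i\sigma_j$ by $\sigma_j\sigma_i\bar\sigma_j\bar\sigma_i$ if $|i-j|=1$ (type I step), by $\sigma_j\bar\sigma_i$ if $|i-j|\ge2$ (type II), or by the empty word if $i=j$ (type III). For reduced $u,v$, every reversing sequence from $\bar u v$ terminates in a word $v'\bar{u'}$ with no subword $\bar\sigma_i\sigma_j$, and the number of type I and type II steps in it is independent of the sequence; this number is $\operatorname{rc}(u,v)$. -}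

module Defs where

open import Data.Nat using (ℕ; zero; suc; _+_; _≤_; _<_; _≡ᵇ_; ∣_-_∣)
open import Data.Bool using (if_then_else_)
open import Data.List using (List; []; _∷_; _++_; map; reverse; length)
open import Data.List.Relation.Unary.All using (All)
open import Data.Product using (_×_; Σ; ∃; ∃-syntax)
open import Relation.Binary.PropositionalEquality using (_≡_; _≢_)

-- A word over the generators: the natural number i stands for σ_i.
Word : Set
Word = List ℕ

IsExpr : ℕ → Word → Set
IsExpr n w = All (λ i → 1 ≤ i × i < n) w

transp : ℕ → ℕ → ℕ
transp i x = if x ≡ᵇ i then suc i else (if x ≡ᵇ suc i then i else x)

-- the permutation represented by a word (letters applied left to right)
act : Word → ℕ → ℕ
act [] x = x
act (i ∷ w) x = act w (transp i x)

Equivalent : Word → Word → Set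
Equivalent u v = ∀ x → act u x ≡ act v x

Reduced : ℕ → Word → Set
Reduced n u = IsExpr n u × (∀ w → IsExpr n w → Equivalent w u → length u ≤ length w)

data BraidStep : Word → Word → Set where
  typeI  : ∀ a b i j → ∣ i - j ∣ ≡ 1 →
           BraidStep (a ++ i ∷ j ∷ i ∷ b) (a ++ j ∷ i ∷ j ∷ b)
  typeII : ∀ a b i j → 2 ≤ ∣ i - j ∣ →
           BraidStep (a ++ i ∷ j ∷ b) (a ++ j ∷ i ∷ b)

data BraidPath : ℕ → Word → Word → Set where
  done : ∀ u → BraidPath 0 u u
  step : ∀ {k u v w} → BraidStep u v → BraidPath k v w → BraidPath (suc k) u w

-- dist(u,v) < r  (dist is the minimal k with a path of length k)
DistLess : Word → Word → ℕ → Set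
DistLess u v r = ∃[ k ] (BraidPath k u v × k < r)

-- letters σ_i and formal inverses σ̄_i
data Letter : Set where
  sig : ℕ → Letter
  bar : ℕ → Letter

barWord : Word → List Letter
barWord u = map bar (reverse u)

barProd : Word → Word → List Letter
barProd u v = barWord u ++ map sig v

data RevStep : ℕ → List Letter → List Letter → Set where
  revI   : ∀ a b i j → ∣ i - j ∣ ≡ 1 →
           RevStep 1 (a ++ bar i ∷ sig j ∷ b) (a ++ sig j ∷ sig i ∷ bar j ∷ bar i ∷ b)
  revII  : ∀ a b i j → 2 ≤ ∣ i - j ∣ →
           RevStep 1 (a ++ bar i ∷ sig j ∷ b) (a ++ sig j ∷ bar i ∷ b)
  revIII : ∀ a b i →
           RevStep 0 (a ++ bar i ∷ sig i ∷ b) (a ++ b)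

data RevSeq : ℕ → List Letter → List Letter → Set where
  done : ∀ w → RevSeq 0 w w
  step : ∀ {c d w w' w''} → RevStep c w w' → RevSeq d w' w'' → RevSeq (c + d) w w''

Terminal : List Letter → Set
Terminal w = ∀ a b i j → w ≢ a ++ bar i ∷ sig j ∷ b

-- rc(u,v) = r : some (hence every) terminating reversing sequence from ū v has r steps of type I/II
RC : Word → Word → ℕ → Set
RC u v r = ∃[ w ] (RevSeq r (barProd u v) w × Terminal w)

{-# OPTIONS --safe #-}
-- Take u = σ₁σ₄σ₂σ₁ and v = σ₂σ₄σ₁σ₂ in S₅.  Three braid moves connect them:
-- commute σ₁σ₄, apply σ₁σ₂σ₁ = σ₂σ₁σ₂, commute σ₄σ₂.  Reversing ū v instead
-- has to move σ̄₄ (from ū) and σ₄ (from v) separately past both σ₁ and σ₂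
-- before they cancel: four type II steps besides the one of type I.
-- That u and v are reduced and equivalent is decided by evaluation: an
-- n-expression fixes every point above n, so permutations need only be
-- compared on 0, …, n, and the shorter n-expressions can be enumerated.
module Submission where

open import Defs
open import Data.Nat using (ℕ; zero; suc; pred; _+_; _≤_; _<_; _≡ᵇ_; z≤n; s≤s)
open import Data.Nat.Properties using (_≟_; _≤?_; _<?_; ≡ᵇ⇒≡; >⇒≢; n≤1+n; ≤-<-trans; ≰⇒>; ≮⇒≥)
open import Data.Bool using (true; false; T)
open import Data.Unit using (tt)
open import Data.List using (List; []; _∷_; length; applyUpTo; upTo; concatMap; cartesianProductWith)
open import Data.List.Relation.Unary.All as All using (All; []; _∷_; all?)
open import Data.List.Relation.Unary.Any as Any using (Any; here; any?)
open import Data.List.Membership.Propositional using (_∈_)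
open import Data.List.Membership.Propositional.Properties
  using (∈-applyUpTo⁺; ∈-upTo⁺; ∈-cartesianProductWith⁺; ∈-concatMap⁺)
open import Data.Product using (_×_; _,_; ∃-syntax)
open import Relation.Nullary using (¬_; yes; no; contradiction)
open import Relation.Nullary.Decidable using (Dec; True; toWitness; ¬?; _×-dec_)
open import Relation.Binary.PropositionalEquality using (_≡_; _≢_; refl; sym; trans; subst)

transp-fixes : ∀ {i x} → suc i < x → transp i x ≡ x
transp-fixes {i} {x} i+1<x with x ≡ᵇ i in x≡ᵇi | x ≡ᵇ suc i in x≡ᵇi+1
... | true  | _     = contradiction (≡ᵇ⇒≡ x i (subst T (sym x≡ᵇi) tt)) (>⇒≢ (≤-<-trans (n≤1+n i) i+1<x))
... | false | true  = contradiction (≡ᵇ⇒≡ x (suc i) (subst T (sym x≡ᵇi+1) tt)) (>⇒≢ i+1<x)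
... | false | false = refl

act-fixes : ∀ {n w x} → IsExpr n w → n < x → act w x ≡ x
act-fixes [] _ = refl
act-fixes ((_ , i<n) ∷ e) n<x rewrite transp-fixes (≤-<-trans i<n n<x) = act-fixes e n<x

AgreeBelow : ℕ → Word → Word → Set
AgreeBelow m u v = All (λ x → act u x ≡ act v x) (upTo m)

agreeBelow⇒equivalent : ∀ {n u v} → IsExpr n u → IsExpr n v → AgreeBelow (suc n) u v → Equivalent u v
agreeBelow⇒equivalent {n} eu ev agree x with x ≤? n
... | yes x≤n = All.lookup agree (∈-upTo⁺ (s≤s x≤n))
... | no  x≰n = trans (act-fixes eu (≰⇒> x≰n)) (sym (act-fixes ev (≰⇒> x≰n)))

DisagreeBelow : ℕ → Word → Word → Set
DisagreeBelow m u v = Any (λ x → act u x ≢ act v x) (upTo m)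

disagreeBelow⇒¬equivalent : ∀ {m u v} → DisagreeBelow m u v → ¬ Equivalent u v
disagreeBelow⇒¬equivalent d u≈v with _ , ux≢vx ← Any.satisfied d = ux≢vx (u≈v _)

generators : ℕ → List ℕ
generators n = applyUpTo suc (pred n)

expressions : ℕ → ℕ → List Word
expressions n zero    = [] ∷ []
expressions n (suc k) = cartesianProductWith _∷_ (generators n) (expressions n k)

shorterExpressions : ℕ → ℕ → List Word
shorterExpressions n k = concatMap (expressions n) (upTo k)

∈-generators : ∀ {n i} → 1 ≤ i → i < n → i ∈ generators n
∈-generators {suc _} {suc _} _ (s≤s j<n) = ∈-applyUpTo⁺ suc j<n

∈-expressions : ∀ {n w} → IsExpr n w → w ∈ expressions n (length w)
∈-expressions []                = here refl
∈-expressions ((1≤i , i<n) ∷ e) = ∈-cartesianProductWith⁺ _∷_ (∈-generators 1≤i i<n) (∈-expressions e)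

∈-shorterExpressions : ∀ {n k w} → IsExpr n w → length w < k → w ∈ shorterExpressions n k
∈-shorterExpressions e lt = ∈-concatMap⁺ (expressions _) (Any.map (λ { refl → ∈-expressions e }) (∈-upTo⁺ lt))

noShorterEquivalent⇒reduced : ∀ {n u} → IsExpr n u →
  All (λ w → ¬ Equivalent w u) (shorterExpressions n (length u)) → Reduced n u
noShorterEquivalent⇒reduced {n} {u} eu none = eu , minimal
  where
  minimal : ∀ w → IsExpr n w → Equivalent w u → length u ≤ length w
  minimal w ew w≈u with length w <? length u
  ... | yes shorter = contradiction w≈u (All.lookup none (∈-shorterExpressions ew shorter))
  ... | no  ¬shorter = ≮⇒≥ ¬shorter

isExpr? : ∀ n w → Dec (IsExpr n w)
isExpr? n = all? (λ i → (1 ≤? i) ×-dec (i <? n))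

agreeBelow? : ∀ m u v → Dec (AgreeBelow m u v)
agreeBelow? m u v = all? (λ x → act u x ≟ act v x) (upTo m)

disagreeBelow? : ∀ m u v → Dec (DisagreeBelow m u v)
disagreeBelow? m u v = any? (λ x → ¬? (act u x ≟ act v x)) (upTo m)

shorterExpressionsDisagree? : ∀ n u →
  Dec (All (λ w → DisagreeBelow (suc n) w u) (shorterExpressions n (length u)))
shorterExpressionsDisagree? n u = all? (λ w → disagreeBelow? (suc n) w u) (shorterExpressions n (length u))

reducedByEvaluation : ∀ n u → {True (isExpr? n u)} → {True (shorterExpressionsDisagree? n u)} → Reduced n u
reducedByEvaluation n u {eu} {d} =
  noShorterEquivalent⇒reduced (toWitness eu) (All.map (λ {w} → disagreeBelow⇒¬equivalent {u = w} {v = u}) (toWitness d))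

equivalentByEvaluation : ∀ n u v → {True (isExpr? n u)} → {True (isExpr? n v)} →
                         {True (agreeBelow? (suc n) u v)} → Equivalent u v
equivalentByEvaluation n u v {eu} {ev} {a} = agreeBelow⇒equivalent (toWitness eu) (toWitness ev) (toWitness a)

module BraidReasoning where
  infixr 2 _≈⟨_⟩_
  infix  3 _∎

  _≈⟨_⟩_ : ∀ u {k v w} → BraidStep u v → BraidPath k v w → BraidPath (suc k) u w
  _ ≈⟨ s ⟩ p = step s p

  _∎ : ∀ u → BraidPath 0 u u
  _∎ = done

module ReversingReasoning where
  infixr 2 _↝⟨_⟩_
  infix  3 _∎

  _↝⟨_⟩_ : ∀ w {c d w′ w″} → RevStep c w w′ → RevSeq d w′ w″ → RevSeq (c + d) w w″
  _ ↝⟨ s ⟩ p = step s p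

  _∎ : ∀ w → RevSeq 0 w w
  _∎ = done

[]-terminal : Terminal []
[]-terminal []      _ _ _ ()
[]-terminal (_ ∷ _) _ _ _ ()

far-apart : ∀ {d} → 2 ≤ 2 + d
far-apart = s≤s (s≤s z≤n)

u v : Word
u = 1 ∷ 4 ∷ 2 ∷ 1 ∷ []
v = 2 ∷ 4 ∷ 1 ∷ 2 ∷ []

u≈ᵇv : BraidPath 3 u v
u≈ᵇv =
  1 ∷ 4 ∷ 2 ∷ 1 ∷ [] ≈⟨ typeII [] (2 ∷ 1 ∷ []) 1 4 far-apart ⟩
  4 ∷ 1 ∷ 2 ∷ 1 ∷ [] ≈⟨ typeI (4 ∷ []) [] 1 2 refl ⟩
  4 ∷ 2 ∷ 1 ∷ 2 ∷ [] ≈⟨ typeII [] (1 ∷ 2 ∷ []) 4 2 far-apart ⟩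
  2 ∷ 4 ∷ 1 ∷ 2 ∷ [] ∎
  where open BraidReasoning

ūv↝[] : RevSeq 5 (barProd u v) []
ūv↝[] =
  bar 1 ∷ bar 2 ∷ bar 4 ∷ bar 1 ∷ sig 2 ∷ sig 4 ∷ sig 1 ∷ sig 2 ∷ []
    ↝⟨ revI (bar 1 ∷ bar 2 ∷ bar 4 ∷ []) (sig 4 ∷ sig 1 ∷ sig 2 ∷ []) 1 2 refl ⟩
  bar 1 ∷ bar 2 ∷ bar 4 ∷ sig 2 ∷ sig 1 ∷ bar 2 ∷ bar 1 ∷ sig 4 ∷ sig 1 ∷ sig 2 ∷ []
    ↝⟨ revII (bar 1 ∷ bar 2 ∷ []) (sig 1 ∷ bar 2 ∷ bar 1 ∷ sig 4 ∷ sig 1 ∷ sig 2 ∷ []) 4 2 far-apart ⟩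
  bar 1 ∷ bar 2 ∷ sig 2 ∷ bar 4 ∷ sig 1 ∷ bar 2 ∷ bar 1 ∷ sig 4 ∷ sig 1 ∷ sig 2 ∷ []
    ↝⟨ revIII (bar 1 ∷ []) (bar 4 ∷ sig 1 ∷ bar 2 ∷ bar 1 ∷ sig 4 ∷ sig 1 ∷ sig 2 ∷ []) 2 ⟩
  bar 1 ∷ bar 4 ∷ sig 1 ∷ bar 2 ∷ bar 1 ∷ sig 4 ∷ sig 1 ∷ sig 2 ∷ []
    ↝⟨ revII (bar 1 ∷ []) (bar 2 ∷ bar 1 ∷ sig 4 ∷ sig 1 ∷ sig 2 ∷ []) 4 1 far-apart ⟩
  bar 1 ∷ sig 1 ∷ bar 4 ∷ bar 2 ∷ bar 1 ∷ sig 4 ∷ sig 1 ∷ sig 2 ∷ []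
    ↝⟨ revIII [] (bar 4 ∷ bar 2 ∷ bar 1 ∷ sig 4 ∷ sig 1 ∷ sig 2 ∷ []) 1 ⟩
  bar 4 ∷ bar 2 ∷ bar 1 ∷ sig 4 ∷ sig 1 ∷ sig 2 ∷ []
    ↝⟨ revII (bar 4 ∷ bar 2 ∷ []) (sig 1 ∷ sig 2 ∷ []) 1 4 far-apart ⟩
  bar 4 ∷ bar 2 ∷ sig 4 ∷ bar 1 ∷ sig 1 ∷ sig 2 ∷ []
    ↝⟨ revII (bar 4 ∷ []) (bar 1 ∷ sig 1 ∷ sig 2 ∷ []) 2 4 far-apart ⟩
  bar 4 ∷ sig 4 ∷ bar 2 ∷ bar 1 ∷ sig 1 ∷ sig 2 ∷ []
    ↝⟨ revIII [] (bar 2 ∷ bar 1 ∷ sig 1 ∷ sig 2 ∷ []) 4 ⟩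
  bar 2 ∷ bar 1 ∷ sig 1 ∷ sig 2 ∷ []
    ↝⟨ revIII (bar 2 ∷ []) (sig 2 ∷ []) 1 ⟩
  bar 2 ∷ sig 2 ∷ []
    ↝⟨ revIII [] [] 2 ⟩
  [] ∎
  where open ReversingReasoning

proposition2p6 : ∃[ n ] ∃[ u ] ∃[ v ]
    (Reduced n u × Reduced n v × Equivalent u v ×
     ∃[ r ] (RC u v r × DistLess u v r))
proposition2p6 =
  5 , u , v ,
  reducedByEvaluation 5 u , reducedByEvaluation 5 v , equivalentByEvaluation 5 u v ,
  5 , ([] , ūv↝[] , []-terminal) , (3 , u≈ᵇv , s≤s (s≤s (s≤s (s≤s z≤n))))
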